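{- Let $G$ be a connected graph and let $G'$ be the graph obtained from $G$ by subdividing every edge exactly once. (i) If $G'$ is a tree, then $\mathrm{czf}(G')=|E(G)|+1=\alpha(G')$. (ii) If $G'$ contains a cycle, then $\mathrm{czf}(G')=|E(G)|=\alpha(G')$.
   Context: All graphs are finite and simple. Subdividing an edge $xy$ once means replacing it by a path $x\,m\,y$ through a new vertex $m$. $\alpha(H)$ denotes the independence number of $H$. Constrained zero forcing: start with a set $S\subseteq V(H)$ of colored vertices, all others uncolored. A colored vertex $c$ may force an uncolored vertex $u$ to become colored if $u$ is the only uncolored neighbor of $c$; only vertices of the initial set $S$ may ever force. $S$ is a constrained zero forcing set if some sequence of forces colors all vertices. $\mathrm{czf}(H)$ is the minimum size of a constrained zero forcing set. -}

module Defs where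

open import Data.Nat using (ℕ; zero; suc; _+_; _<_; _≤_)
open import Data.Fin using (Fin; toℕ; splitAt; inject₁; fromℕ)
import Data.Fin as F
open import Data.Fin.Subset using (Subset; _∈_; _∉_; _∪_; ⁅_⁆; ∣_∣; ⊤)
open import Data.List using (List; length; lookup)
open import Data.List.Relation.Unary.All using (All)
open import Data.List.Relation.Unary.Unique.Propositional using (Unique)
open import Data.Product using (Σ; _×_; _,_; proj₁; proj₂)
open import Data.Sum using (_⊎_; inj₁; inj₂)
open import Data.Empty using (⊥)
open import Relation.Nullary using (¬_)
open import Relation.Binary.PropositionalEquality using (_≡_; _≢_)
open import Relation.Binary.Construct.Closure.ReflexiveTransitive using (Star)
open import Function.Definitions using (Injective)

Adjacency : ℕ → Set₁
Adjacency N = Fin N → Fin N → Set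

-- One constrained force: colored c ∈ S (initial set) forces u, its unique
-- uncolored neighbour.
data ForceStep {N : ℕ} (A : Adjacency N) (S : Subset N) : Subset N → Subset N → Set where
  force : ∀ {C} (c u : Fin N) → c ∈ S → c ∈ C → A c u → u ∉ C →
          (∀ w → A c w → w ≢ u → w ∈ C) →
          ForceStep A S C (C ∪ ⁅ u ⁆)

IsCZFSet : {N : ℕ} → Adjacency N → Subset N → Set
IsCZFSet A S = Star (ForceStep A S) S ⊤

IsCZFNumber : {N : ℕ} → Adjacency N → ℕ → Set
IsCZFNumber {N} A k =
  (Σ (Subset N) λ S → IsCZFSet A S × ∣ S ∣ ≡ k) ×
  (∀ (S : Subset N) → IsCZFSet A S → k ≤ ∣ S ∣)

Independent : {N : ℕ} → Adjacency N → Subset N → Set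
Independent A I = ∀ x y → x ∈ I → y ∈ I → ¬ A x y

IsIndependenceNumber : {N : ℕ} → Adjacency N → ℕ → Set
IsIndependenceNumber {N} A k =
  (Σ (Subset N) λ I → Independent A I × ∣ I ∣ ≡ k) ×
  (∀ (I : Subset N) → Independent A I → ∣ I ∣ ≤ k)

Connected : {N : ℕ} → Adjacency N → Set
Connected {N} A = Fin N × (∀ i j → Star A i j)

HasCycle : {N : ℕ} → Adjacency N → Set
HasCycle {N} A = Σ ℕ λ k → Σ (Fin (3 + k) → Fin N) λ v →
  Injective _≡_ _≡_ v ×
  (∀ (i : Fin (2 + k)) → A (v (inject₁ i)) (v (F.suc i))) ×
  A (v (fromℕ (2 + k))) (v F.zero)

IsTree : {N : ℕ} → Adjacency N → Set
IsTree A = Connected A × ¬ HasCycle A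

record SimpleGraph : Set where
  field
    n       : ℕ
    edges   : List (Fin n × Fin n)
    ordered : All (λ e → toℕ (proj₁ e) < toℕ (proj₂ e)) edges
    unique  : Unique edges
open SimpleGraph public

numEdges : SimpleGraph → ℕ
numEdges G = length (edges G)

adj : (G : SimpleGraph) → Adjacency (n G)
adj G i j = Data.List.Membership.Propositional._∈_ (i , j) (edges G)
          ⊎ Data.List.Membership.Propositional._∈_ (j , i) (edges G)
  where import Data.List.Membership.Propositional

-- Subdivision G': vertices Fin (n + m); the first n are the original
-- vertices, vertex n + e is the subdivision vertex of the e-th edge.
IsEndpoint : (G : SimpleGraph) → Fin (n G) → Fin (numEdges G) → Set
IsEndpoint G x e = x ≡ proj₁ (lookup (edges G) e) ⊎ x ≡ proj₂ (lookup (edges G) e)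

subAdjSplit : (G : SimpleGraph) → Fin (n G) ⊎ Fin (numEdges G) → Fin (n G) ⊎ Fin (numEdges G) → Set
subAdjSplit G (inj₁ x) (inj₂ e) = IsEndpoint G x e
subAdjSplit G (inj₂ e) (inj₁ x) = IsEndpoint G x e
subAdjSplit G _ _ = ⊥

subdivision : (G : SimpleGraph) → Adjacency (n G + numEdges G)
subdivision G a b = subAdjSplit G (splitAt (n G) a) (splitAt (n G) b)

{-# OPTIONS --safe #-}
-- Any constrained zero forcing set S is at least as large as any independent set I: a force of a
-- vertex of I is charged to its forcer, which lies outside I and can never force again, so I ∖ S
-- injects into S ∖ I.  It therefore suffices to exhibit a forcing set and an independent set of
-- equal size.  In G′ the |E| midpoints are independent, and so are the |V| vertices of G.  From one
-- vertex r and all midpoints, a midpoint with one coloured end forces the other end, so colour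
-- spreads through G: a forcing set of size |E| + 1.  A cycle of G′ through the midpoint of e amounts
-- to a walk between the ends of e avoiding e.  If G′ is a tree, every edge is therefore a bridge and
-- a spanning tree gives |E| < |V|, while |V| ≤ |E| + 1 by the inequality above.  Otherwise some e is
-- not a bridge: from one end a of e and all other midpoints, walks avoiding e colour all of G, after
-- which a forces the midpoint of e, giving a forcing set of size |E|.
module Submission where

open import Defs
open import Data.Nat using (ℕ; zero; suc; _+_; _∸_; _≤_; _<_; z≤n; s≤s)
open import Data.Nat.Properties
  using (≤-refl; ≤-trans; ≤-reflexive; ≤-antisym; <-irrefl; <⇒≱; n≤1+n; m≤m+n;
         +-suc; +-comm; +-monoʳ-≤; +-identityʳ)
open import Data.Product using (∃; ∃₂; _×_; _,_; proj₁; proj₂)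
open import Data.Sum using (_⊎_; inj₁; inj₂)
import Data.Sum as Sum
open import Data.Unit using (tt)
open import Data.Empty using (⊥-elim)
open import Data.Fin using (Fin; toℕ; splitAt; join; inject₁; fromℕ; _↑ˡ_; _↑ʳ_)
import Data.Fin as F
import Data.Fin.Properties as FinP
open import Data.Fin.Subset using (Subset; _∈_; _∉_; _∪_; _∩_; ⁅_⁆; ∣_∣; ⊤; ⊥; ∁; _⊆_; inside; outside)
open import Data.Fin.Subset.Properties
  using (_∈?_; p⊆q⇒∣p∣≤∣q∣; p⊂q⇒∣p∣<∣q∣; x∈p∪q⁻; p⊆p∪q; q⊆p∪q; x∈⁅x⁆; x∈⁅y⁆⇒x≡y; x≢y⇒x∉⁅y⁆;
         x∈p∩q⁺; x∈p∩q⁻; x∉p⇒x∈∁p; x∈∁p⇒x∉p; ∉⊥; ∈⊤; ⊆⊤; ⊆-antisym; ∣p∣≤n; ∣⊤∣≡n; ∣⊥∣≡0; ∣⁅x⁆∣≡1;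
         ∣∁p∣≡n∸∣p∣; ∩-identityʳ)
open import Data.Vec using ([]; _∷_; _++_; here; there)
open import Data.List using (List; []; _∷_; length; lookup)
open import Data.List.Relation.Unary.All using (All; []; _∷_)
import Data.List.Relation.Unary.All as All
open import Data.List.Relation.Unary.All.Properties using (¬Any⇒All¬)
open import Data.List.Relation.Unary.AllPairs using ([]; _∷_)
import Data.List.Relation.Unary.Any as Any
open import Data.List.Relation.Unary.Any using (here; there)
open import Data.List.Relation.Unary.Any.Properties using (lookup-index)
open import Data.List.Relation.Unary.Linked using (Linked; []; [-]; _∷_)
import Data.List.Relation.Unary.Linked as Linked
open import Data.List.Relation.Unary.Unique.Propositional using (Unique)
open import Data.List.Membership.Propositional using () renaming (_∈_ to _∈ₗ_)
open import Data.List.Membership.Propositional.Properties using (∈-lookup)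
import Data.List.Membership.DecPropositional as DecMembership
open import Function using (_∘′_; id)
open import Level using (0ℓ)
open import Relation.Nullary using (¬_; yes; no)
open import Relation.Nullary.Decidable using (decidable-stable)
open import Relation.Unary using (Pred; Decidable; U)
open import Relation.Binary using (Rel; DecidableEquality)
open import Relation.Binary.PropositionalEquality
  using (_≡_; _≢_; refl; sym; trans; cong; cong₂; subst; subst₂; ≢-sym)
open import Relation.Binary.Construct.Closure.ReflexiveTransitive using (Star; ε; _◅_; _◅◅_; gmap; concat)
import Relation.Binary.Construct.Closure.ReflexiveTransitive as Star

∀-or-∃¬ : ∀ {n} {P : Pred (Fin n) 0ℓ} → Decidable P → (∀ x → P x) ⊎ ∃ λ x → ¬ P x
∀-or-∃¬ {n} P? with FinP.all? P?
... | yes all = inj₁ all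
... | no ¬all = inj₂ (FinP.¬∀⟶∃¬ n _ P? ¬all)

∣p∪q∣≤∣p∣+∣q∣ : ∀ {N} (p q : Subset N) → ∣ p ∪ q ∣ ≤ ∣ p ∣ + ∣ q ∣
∣p∪q∣≤∣p∣+∣q∣ [] [] = z≤n
∣p∪q∣≤∣p∣+∣q∣ (outside ∷ p) (outside ∷ q) = ∣p∪q∣≤∣p∣+∣q∣ p q
∣p∪q∣≤∣p∣+∣q∣ (outside ∷ p) (inside ∷ q) =
  ≤-trans (s≤s (∣p∪q∣≤∣p∣+∣q∣ p q)) (≤-reflexive (sym (+-suc ∣ p ∣ ∣ q ∣)))
∣p∪q∣≤∣p∣+∣q∣ (inside ∷ p) (outside ∷ q) = s≤s (∣p∪q∣≤∣p∣+∣q∣ p q)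
∣p∪q∣≤∣p∣+∣q∣ (inside ∷ p) (inside ∷ q) =
  s≤s (≤-trans (∣p∪q∣≤∣p∣+∣q∣ p q) (≤-trans (n≤1+n _) (≤-reflexive (sym (+-suc ∣ p ∣ ∣ q ∣)))))

∣p∪⁅x⁆∣≤1+∣p∣ : ∀ {N} (p : Subset N) x → ∣ p ∪ ⁅ x ⁆ ∣ ≤ suc ∣ p ∣
∣p∪⁅x⁆∣≤1+∣p∣ p x = ≤-trans (∣p∪q∣≤∣p∣+∣q∣ p ⁅ x ⁆)
  (≤-reflexive (trans (cong (∣ p ∣ +_) (∣⁅x⁆∣≡1 x)) (+-comm ∣ p ∣ 1)))

x∉p⇒∣p∣<∣p∪⁅x⁆∣ : ∀ {N} (p : Subset N) {x} → x ∉ p → ∣ p ∣ < ∣ p ∪ ⁅ x ⁆ ∣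
x∉p⇒∣p∣<∣p∪⁅x⁆∣ p {x} x∉p = p⊂q⇒∣p∣<∣q∣ (p⊆p∪q ⁅ x ⁆ , x , q⊆p∪q p ⁅ x ⁆ (x∈⁅x⁆ x) , x∉p)

x∉p⇒∣p∣<n : ∀ {N} (p : Subset N) {x} → x ∉ p → ∣ p ∣ < N
x∉p⇒∣p∣<n {N} p {x} x∉p = ≤-trans (p⊂q⇒∣p∣<∣q∣ ((λ _ → ∈⊤) , x , ∈⊤ , x∉p)) (≤-reflexive (∣⊤∣≡n N))

x∈p∪⁅y⁆⁻ : ∀ {N} (p : Subset N) {x} y → x ∈ p ∪ ⁅ y ⁆ → x ∈ p ⊎ x ≡ y
x∈p∪⁅y⁆⁻ p y x∈ = Sum.map₂ (x∈⁅y⁆⇒x≡y y) (x∈p∪q⁻ p ⁅ y ⁆ x∈)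

p∩[q∪⁅x⁆]⊆[p∩q]∪⁅x⁆ : ∀ {N} (p q : Subset N) x → p ∩ (q ∪ ⁅ x ⁆) ⊆ (p ∩ q) ∪ ⁅ x ⁆
p∩[q∪⁅x⁆]⊆[p∩q]∪⁅x⁆ p q x h with x∈p∩q⁻ p _ h
... | y∈p , y∈q∪x with x∈p∪⁅y⁆⁻ q x y∈q∪x
...   | inj₁ y∈q = p⊆p∪q ⁅ x ⁆ (x∈p∩q⁺ (y∈p , y∈q))
...   | inj₂ refl = q⊆p∪q (p ∩ q) ⁅ x ⁆ (x∈⁅x⁆ x)

x∉p⇒p∩[q∪⁅x⁆]⊆p∩q : ∀ {N} (p q : Subset N) {x} → x ∉ p → p ∩ (q ∪ ⁅ x ⁆) ⊆ p ∩ q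
x∉p⇒p∩[q∪⁅x⁆]⊆p∩q p q {x} x∉p h with x∈p∩q⁻ p _ h
... | y∈p , y∈q∪x with x∈p∪⁅y⁆⁻ q x y∈q∪x
...   | inj₁ y∈q = x∈p∩q⁺ (y∈p , y∈q)
...   | inj₂ refl = ⊥-elim (x∉p y∈p)

∈-++⁺ˡ : ∀ {a b} {p : Subset a} {q : Subset b} {y} → y ∈ p → y ↑ˡ b ∈ p ++ q
∈-++⁺ˡ here = here
∈-++⁺ˡ (there y∈p) = there (∈-++⁺ˡ y∈p)

∈-++⁻ˡ : ∀ {a b} {p : Subset a} (q : Subset b) {y} → y ↑ˡ b ∈ p ++ q → y ∈ p
∈-++⁻ˡ {p = inside ∷ p} q {F.zero} here = here
∈-++⁻ˡ {p = _ ∷ p} q {F.suc y} (there y∈) = there (∈-++⁻ˡ q y∈)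

∈-++⁺ʳ : ∀ {a b} (p : Subset a) {q : Subset b} {f} → f ∈ q → a ↑ʳ f ∈ p ++ q
∈-++⁺ʳ [] f∈q = f∈q
∈-++⁺ʳ (_ ∷ p) f∈q = there (∈-++⁺ʳ p f∈q)

∈-++⁻ʳ : ∀ {a b} (p : Subset a) {q : Subset b} {f} → a ↑ʳ f ∈ p ++ q → f ∈ q
∈-++⁻ʳ [] f∈ = f∈
∈-++⁻ʳ (_ ∷ p) (there f∈) = ∈-++⁻ʳ p f∈

∣p++q∣≡∣p∣+∣q∣ : ∀ {a b} (p : Subset a) (q : Subset b) → ∣ p ++ q ∣ ≡ ∣ p ∣ + ∣ q ∣
∣p++q∣≡∣p∣+∣q∣ [] q = refl
∣p++q∣≡∣p∣+∣q∣ (outside ∷ p) q = ∣p++q∣≡∣p∣+∣q∣ p q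
∣p++q∣≡∣p∣+∣q∣ (inside ∷ p) q = cong suc (∣p++q∣≡∣p∣+∣q∣ p q)

∣⁅x⁆++p∣≡1+∣p∣ : ∀ {a b} (x : Fin a) (p : Subset b) → ∣ ⁅ x ⁆ ++ p ∣ ≡ suc ∣ p ∣
∣⁅x⁆++p∣≡1+∣p∣ x p = trans (∣p++q∣≡∣p∣+∣q∣ ⁅ x ⁆ p) (cong (_+ ∣ p ∣) (∣⁅x⁆∣≡1 x))

1+∣∁⁅x⁆∣≡n : ∀ {N} (x : Fin N) → suc ∣ ∁ ⁅ x ⁆ ∣ ≡ N
1+∣∁⁅x⁆∣≡n {suc N} x = cong suc (trans (∣∁p∣≡n∸∣p∣ ⁅ x ⁆) (cong (suc N ∸_) (∣⁅x⁆∣≡1 x)))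

Exhausted : ∀ {N} → Adjacency N → Subset N → Fin N → Set
Exhausted A C t = ∀ w → A t w → w ∈ C

exhausted-∪ : ∀ {N} {A : Adjacency N} {C t} D → Exhausted A C t → Exhausted A (C ∪ D) t
exhausted-∪ D exhausted w Atw = p⊆p∪q D (exhausted w Atw)

forcing-⊆ : ∀ {N} {A : Adjacency N} {S C C'} → Star (ForceStep A S) C C' → C ⊆ C'
forcing-⊆ ε = λ h → h
forcing-⊆ (force _ u _ _ _ _ _ ◅ steps) = λ h → forcing-⊆ steps (p⊆p∪q ⁅ u ⁆ h)

module _ {N : ℕ} {A : Adjacency N} {S I : Subset N} (indep : Independent A I) where

  record Ledger (C : Subset N) : Set where
    field
      charged   : Subset N
      charged⊆S : charged ⊆ S
      paid      : ∀ {t} → t ∈ charged → t ∈ I ⊎ Exhausted A C t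
      bound     : ∣ I ∩ C ∣ ≤ ∣ charged ∣

  -- A force c → u with u ∈ I is charged to c, which is outside I and not yet exhausted, hence
  -- not yet charged; afterwards c is exhausted.
  ledger-step : ∀ {C C'} → ForceStep A S C C' → Ledger C → Ledger C'
  ledger-step {C} (force c u c∈S c∈C Acu u∉C others) L with u ∈? I
  ... | no u∉I = record
    { charged = charged ; charged⊆S = charged⊆S
    ; paid = λ t∈ → Sum.map₂ (exhausted-∪ {A = A} ⁅ u ⁆) (paid t∈)
    ; bound = ≤-trans (p⊆q⇒∣p∣≤∣q∣ (x∉p⇒p∩[q∪⁅x⁆]⊆p∩q I C u∉I)) bound }
    where open Ledger L
  ... | yes u∈I = record
    { charged = charged ∪ ⁅ c ⁆ ; charged⊆S = charged'⊆S ; paid = paid' ; bound = bound' }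
    where
    open Ledger L
    c-exhausted : Exhausted A (C ∪ ⁅ u ⁆) c
    c-exhausted w Acw with w FinP.≟ u
    ... | yes refl = q⊆p∪q C ⁅ u ⁆ (x∈⁅x⁆ u)
    ... | no w≢u = p⊆p∪q ⁅ u ⁆ (others w Acw w≢u)
    c∉charged : c ∉ charged
    c∉charged c∈ with paid c∈
    ... | inj₁ c∈I = indep c u c∈I u∈I Acu
    ... | inj₂ ex = u∉C (ex u Acu)
    charged'⊆S : charged ∪ ⁅ c ⁆ ⊆ S
    charged'⊆S t∈ with x∈p∪⁅y⁆⁻ charged c t∈
    ... | inj₁ t∈charged = charged⊆S t∈charged
    ... | inj₂ refl = c∈S
    paid' : ∀ {t} → t ∈ charged ∪ ⁅ c ⁆ → t ∈ I ⊎ Exhausted A (C ∪ ⁅ u ⁆) t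
    paid' t∈ with x∈p∪⁅y⁆⁻ charged c t∈
    ... | inj₁ t∈charged = Sum.map₂ (exhausted-∪ {A = A} ⁅ u ⁆) (paid t∈charged)
    ... | inj₂ refl = inj₂ c-exhausted
    bound' : ∣ I ∩ (C ∪ ⁅ u ⁆) ∣ ≤ ∣ charged ∪ ⁅ c ⁆ ∣
    bound' = ≤-trans (p⊆q⇒∣p∣≤∣q∣ (p∩[q∪⁅x⁆]⊆[p∩q]∪⁅x⁆ I C u))
             (≤-trans (∣p∪⁅x⁆∣≤1+∣p∣ (I ∩ C) u)
             (≤-trans (s≤s bound) (x∉p⇒∣p∣<∣p∪⁅x⁆∣ charged c∉charged)))

  ledger-star : ∀ {C C'} → Star (ForceStep A S) C C' → Ledger C → Ledger C'
  ledger-star ε L = L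
  ledger-star (step ◅ steps) L = ledger-star steps (ledger-step step L)

  independent≤czf : IsCZFSet A S → ∣ I ∣ ≤ ∣ S ∣
  independent≤czf czf =
    ≤-trans (≤-reflexive (cong ∣_∣ (sym (∩-identityʳ I))))
      (≤-trans bound (p⊆q⇒∣p∣≤∣q∣ charged⊆S))
    where
    initial : Ledger S
    initial = record { charged = I ∩ S ; charged⊆S = λ h → proj₂ (x∈p∩q⁻ I S h)
                     ; paid = λ h → inj₁ (proj₁ (x∈p∩q⁻ I S h)) ; bound = ≤-refl }
    open Ledger (ledger-star czf initial)

czf≡α : ∀ {N} {A : Adjacency N} {S I : Subset N} {k} →
        IsCZFSet A S → Independent A I → ∣ S ∣ ≡ k → ∣ I ∣ ≡ k →
        IsCZFNumber A k × IsIndependenceNumber A k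
czf≡α {S = S} {I} czf indep ∣S∣≡k ∣I∣≡k =
  ((S , czf , ∣S∣≡k) , λ S' czf' → subst (_≤ ∣ S' ∣) ∣I∣≡k (independent≤czf indep czf')) ,
  ((I , indep , ∣I∣≡k) , λ I' indep' → subst (∣ I' ∣ ≤_) ∣S∣≡k (independent≤czf indep' czf))

module _ {N : ℕ} (Inv Done : Subset N → Set)
         (extend : ∀ C → Inv C → Done C ⊎ ∃ λ z → z ∉ C × Inv (C ∪ ⁅ z ⁆)) where

  saturate-within : ∀ k C → N ≤ k + ∣ C ∣ → Inv C → ∃ λ C' → Inv C' × Done C'
  saturate-within k C room inv with extend C inv
  ... | inj₁ done = C , inv , done
  saturate-within zero C room inv | inj₂ (z , z∉C , _) = ⊥-elim (<⇒≱ (x∉p⇒∣p∣<n C z∉C) room)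
  saturate-within (suc k) C room inv | inj₂ (z , z∉C , inv') =
    saturate-within k (C ∪ ⁅ z ⁆)
      (≤-trans room (≤-trans (≤-reflexive (sym (+-suc k ∣ C ∣)))
                             (+-monoʳ-≤ k (x∉p⇒∣p∣<∣p∪⁅x⁆∣ C z∉C))))
      inv'

  saturate : ∀ C → Inv C → ∃ λ C' → Inv C' × Done C'
  saturate C = saturate-within N C (m≤m+n N ∣ C ∣)

Star-crossing : ∀ {V : Set} {R : Rel V 0ℓ} {P : Pred V 0ℓ} → Decidable P →
                ∀ {a b} → Star R a b → P a → ¬ P b → ∃₂ λ x z → R x z × P x × ¬ P z
Star-crossing P? ε Pa ¬Pb = ⊥-elim (¬Pb Pa)
Star-crossing P? (_◅_ {j = y} r steps) Pa ¬Pb with P? y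
... | yes Py = Star-crossing P? steps Py ¬Pb
... | no ¬Py = _ , y , r , Pa , ¬Py

lastOf : ∀ {V : Set} → V → List V → V
lastOf x [] = x
lastOf x (y ∷ ys) = lastOf y ys

lookup-fromℕ : ∀ {V : Set} (x : V) ys → lookup (x ∷ ys) (fromℕ (length ys)) ≡ lastOf x ys
lookup-fromℕ x [] = refl
lookup-fromℕ x (y ∷ ys) = lookup-fromℕ y ys

lookup-injective : ∀ {V : Set} {xs : List V} → Unique xs → ∀ {i j} → lookup xs i ≡ lookup xs j → i ≡ j
lookup-injective (_ ∷ _) {F.zero} {F.zero} eq = refl
lookup-injective (x∉ ∷ _) {F.zero} {F.suc j} eq = ⊥-elim (All.lookup x∉ (∈-lookup j) eq)
lookup-injective (x∉ ∷ _) {F.suc i} {F.zero} eq = ⊥-elim (All.lookup x∉ (∈-lookup i) (sym eq))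
lookup-injective (_ ∷ u) {F.suc i} {F.suc j} eq = cong F.suc (lookup-injective u eq)

linked-lookup : ∀ {V : Set} {R : Rel V 0ℓ} {x ys} → Linked R (x ∷ ys) →
                ∀ (i : Fin (length ys)) → R (lookup (x ∷ ys) (inject₁ i)) (lookup (x ∷ ys) (F.suc i))
linked-lookup (r ∷ _) F.zero = r
linked-lookup (_ ∷ l) (F.suc i) = linked-lookup l i

walk-along : ∀ {V : Set} {R : Rel V 0ℓ} l (w : Fin (suc l) → V) →
             (∀ (i : Fin l) → R (w (inject₁ i)) (w (F.suc i))) → Star R (w F.zero) (w (fromℕ l))
walk-along zero w steps = ε
walk-along (suc l) w steps = steps F.zero ◅ walk-along l (λ i → w (F.suc i)) (λ i → steps (F.suc i))

record SimplePath {V : Set} (R : Rel V 0ℓ) (a b : V) : Set where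
  field
    rest   : List V
    linked : Linked R (a ∷ rest)
    simple : Unique (a ∷ rest)
    ends   : lastOf a rest ≡ b

module _ {V : Set} (_≟_ : DecidableEquality V) {R : Rel V 0ℓ} where

  suffix : ∀ {x a b} (P : SimplePath R a b) → x ∈ₗ a ∷ SimplePath.rest P → SimplePath R x b
  suffix P (here refl) = P
  suffix record { rest = y ∷ ys ; linked = _ ∷ l ; simple = _ ∷ u ; ends = e } (there x∈) =
    suffix record { rest = ys ; linked = l ; simple = u ; ends = e } x∈

  loop-erase : ∀ {a b} → Star R a b → SimplePath R a b
  loop-erase ε = record { rest = [] ; linked = [-] ; simple = [] ∷ [] ; ends = refl }
  loop-erase {a} (r ◅ steps) with loop-erase steps
  ... | P with DecMembership._∈?_ _≟_ a (_ ∷ SimplePath.rest P)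
  ...   | yes a∈ = suffix P a∈
  ...   | no a∉ = record { rest = _ ∷ rest ; linked = r ∷ linked
                         ; simple = ¬Any⇒All¬ _ a∉ ∷ simple ; ends = ends }
    where open SimplePath P

module _ {N : ℕ} (A : Adjacency N) where

  Avoiding : Fin N → Rel (Fin N) 0ℓ
  Avoiding X u v = A u v × u ≢ X × v ≢ X

  Detour : Fin N → Set
  Detour X = ∃₂ λ p q → p ≢ q × A X p × A q X × Star (Avoiding X) p q

  avoiding⇒all≢ : ∀ {X x y ys} → Linked (Avoiding X) (x ∷ y ∷ ys) → All (X ≢_) (x ∷ y ∷ ys)
  avoiding⇒all≢ ((_ , x≢X , y≢X) ∷ [-]) = ≢-sym x≢X ∷ ≢-sym y≢X ∷ []
  avoiding⇒all≢ ((_ , x≢X , _) ∷ l@(_ ∷ _)) = ≢-sym x≢X ∷ avoiding⇒all≢ l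

  detour⇒cycle : ∀ {X} → Detour X → HasCycle A
  detour⇒cycle {X} (p , q , p≢q , AXp , AqX , walk) with loop-erase F._≟_ walk
  ... | record { rest = [] ; ends = p≡q } = ⊥-elim (p≢q p≡q)
  ... | record { rest = y ∷ ys ; linked = l ; simple = u ; ends = e } =
    length ys , lookup (X ∷ p ∷ y ∷ ys) , lookup-injective (avoiding⇒all≢ l ∷ u) ,
    linked-lookup (AXp ∷ Linked.map proj₁ l) ,
    subst (λ z → A z X) (sym (trans (lookup-fromℕ X (p ∷ y ∷ ys)) e)) AqX

  module _ {k : ℕ} {v : Fin (3 + k) → Fin N} (inj : ∀ {i j} → v i ≡ v j → i ≡ j)
           (consecutive : ∀ (i : Fin (2 + k)) → A (v (inject₁ i)) (v (F.suc i)))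
           (closing : A (v (fromℕ (2 + k))) (v F.zero)) where

    private
      distinct : ∀ {i j} → i ≢ j → v i ≢ v j
      distinct i≢j eq = i≢j (inj eq)

    cycle⇒detour₀ : Detour (v F.zero)
    cycle⇒detour₀ =
      v (F.suc F.zero) , v (fromℕ (2 + k)) , distinct (λ ()) , consecutive F.zero , closing ,
      walk-along (suc k) (λ i → v (F.suc i))
        (λ i → consecutive (F.suc i) , distinct (λ ()) , distinct (λ ()))

    cycle⇒detour₁ : Detour (v (F.suc F.zero))
    cycle⇒detour₁ =
      v (F.suc (F.suc F.zero)) , v F.zero , distinct (λ ()) ,
      consecutive (F.suc F.zero) , consecutive F.zero ,
      walk-along k (λ i → v (F.suc (F.suc i)))
        (λ i → consecutive (F.suc (F.suc i)) , distinct (λ ()) , distinct (λ ()))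
      ◅◅ (closing , distinct (λ ()) , distinct (λ ())) ◅ ε

module Subdivision (G : SimpleGraph) where

  nV nE : ℕ
  nV = n G
  nE = numEdges G

  A′ : Adjacency (nV + nE)
  A′ = subdivision G

  vertex : Fin nV → Fin (nV + nE)
  vertex y = y ↑ˡ nE

  midpoint : Fin nE → Fin (nV + nE)
  midpoint f = nV ↑ʳ f

  data Kind : Fin (nV + nE) → Set where
    original : ∀ y → Kind (vertex y)
    middle   : ∀ f → Kind (midpoint f)

  kind : ∀ w → Kind w
  kind w = subst Kind (FinP.join-splitAt nV nE w) (kind-join (splitAt nV w))
    where
    kind-join : ∀ α → Kind (join nV nE α)
    kind-join (inj₁ y) = original y
    kind-join (inj₂ f) = middle f

  vertex-injective : ∀ {y z} → vertex y ≡ vertex z → y ≡ z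
  vertex-injective = FinP.↑ˡ-injective nE _ _

  midpoint-injective : ∀ {f g} → midpoint f ≡ midpoint g → f ≡ g
  midpoint-injective = FinP.↑ʳ-injective nV _ _

  vertex≢midpoint : ∀ {y f} → vertex y ≢ midpoint f
  vertex≢midpoint {y} {f} eq
    with trans (sym (FinP.splitAt-↑ˡ nV y nE)) (trans (cong (splitAt nV) eq) (FinP.splitAt-↑ʳ nV nE f))
  ... | ()

  A′-join : ∀ α β → A′ (join nV nE α) (join nV nE β) ≡ subAdjSplit G α β
  A′-join α β = cong₂ (subAdjSplit G) (FinP.splitAt-join nV nE α) (FinP.splitAt-join nV nE β)

  vertex-midpoint : ∀ {y f} → IsEndpoint G y f → A′ (vertex y) (midpoint f)
  vertex-midpoint {y} {f} = subst id (sym (A′-join (inj₁ y) (inj₂ f)))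

  midpoint-vertex : ∀ {y f} → IsEndpoint G y f → A′ (midpoint f) (vertex y)
  midpoint-vertex {y} {f} = subst id (sym (A′-join (inj₂ f) (inj₁ y)))

  vertex-midpoint⁻ : ∀ {y f} → A′ (vertex y) (midpoint f) → IsEndpoint G y f
  vertex-midpoint⁻ {y} {f} = subst id (A′-join (inj₁ y) (inj₂ f))

  midpoint-vertex⁻ : ∀ {y f} → A′ (midpoint f) (vertex y) → IsEndpoint G y f
  midpoint-vertex⁻ {y} {f} = subst id (A′-join (inj₂ f) (inj₁ y))

  vertex-vertex⁻ : ∀ {y z} → ¬ A′ (vertex y) (vertex z)
  vertex-vertex⁻ {y} {z} = subst id (A′-join (inj₁ y) (inj₁ z))

  midpoint-midpoint⁻ : ∀ {f g} → ¬ A′ (midpoint f) (midpoint g)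
  midpoint-midpoint⁻ {f} {g} = subst id (A′-join (inj₂ f) (inj₂ g))

  neighbour-of-vertex : ∀ {y w} → A′ (vertex y) w → ∃ λ f → w ≡ midpoint f × IsEndpoint G y f
  neighbour-of-vertex {w = w} a with kind w
  ... | original z = ⊥-elim (vertex-vertex⁻ a)
  ... | middle f = f , refl , vertex-midpoint⁻ a

  neighbour-of-midpoint : ∀ {f w} → A′ (midpoint f) w → ∃ λ y → w ≡ vertex y × IsEndpoint G y f
  neighbour-of-midpoint {w = w} a with kind w
  ... | original y = y , refl , midpoint-vertex⁻ a
  ... | middle g = ⊥-elim (midpoint-midpoint⁻ a)

  neighbour-of-midpoint′ : ∀ {f w} → A′ w (midpoint f) → ∃ λ y → w ≡ vertex y × IsEndpoint G y f
  neighbour-of-midpoint′ {w = w} a with kind w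
  ... | original y = y , refl , vertex-midpoint⁻ a
  ... | middle g = ⊥-elim (midpoint-midpoint⁻ a)

  end₁ end₂ : Fin nE → Fin nV
  end₁ f = proj₁ (lookup (edges G) f)
  end₂ f = proj₂ (lookup (edges G) f)

  end₁≢end₂ : ∀ f → end₁ f ≢ end₂ f
  end₁≢end₂ f eq = <-irrefl (cong toℕ eq) (All.lookup (ordered G) (∈-lookup f))

  other-endpoint : ∀ {f w y z} → IsEndpoint G w f → IsEndpoint G y f → IsEndpoint G z f →
                   y ≢ z → w ≢ z → w ≡ y
  other-endpoint (inj₁ refl) (inj₁ refl) _ _ _ = refl
  other-endpoint (inj₂ refl) (inj₂ refl) _ _ _ = refl
  other-endpoint (inj₁ refl) (inj₂ refl) (inj₁ refl) _ w≢z = ⊥-elim (w≢z refl)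
  other-endpoint (inj₁ refl) (inj₂ refl) (inj₂ refl) y≢z _ = ⊥-elim (y≢z refl)
  other-endpoint (inj₂ refl) (inj₁ refl) (inj₁ refl) y≢z _ = ⊥-elim (y≢z refl)
  other-endpoint (inj₂ refl) (inj₁ refl) (inj₂ refl) _ w≢z = ⊥-elim (w≢z refl)

  Joined : Pred (Fin nE) 0ℓ → Rel (Fin nV) 0ℓ
  Joined P y z = ∃ λ f → P f × IsEndpoint G y f × IsEndpoint G z f

  Walk : Pred (Fin nE) 0ℓ → Rel (Fin nV) 0ℓ
  Walk P = Star (Joined P)

  walk-reverse : ∀ {P a b} → Walk P a b → Walk P b a
  walk-reverse = Star.reverse (λ (f , Pf , ey , ez) → f , Pf , ez , ey)

  walk-restrict : ∀ {P Q : Pred (Fin nE) 0ℓ} → (∀ {f} → P f → Q f) → ∀ {a b} → Walk P a b → Walk Q a b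
  walk-restrict P⇒Q = Star.map (λ (f , Pf , ey , ez) → f , P⇒Q Pf , ey , ez)

  connected⇒walk : Connected (adj G) → ∀ y z → Walk U y z
  connected⇒walk (_ , star) y z = Star.map edge (star y z)
    where
    edge : ∀ {y z} → adj G y z → Joined U y z
    edge (inj₁ yz∈) = Any.index yz∈ , tt , inj₁ (cong proj₁ (lookup-index yz∈)) ,
                                            inj₂ (cong proj₂ (lookup-index yz∈))
    edge (inj₂ zy∈) = Any.index zy∈ , tt , inj₂ (cong proj₂ (lookup-index zy∈)) ,
                                            inj₁ (cong proj₁ (lookup-index zy∈))

  NonBridge : Fin nE → Set
  NonBridge e = Walk (_≢ e) (end₁ e) (end₂ e)

  reroute : ∀ {e} → NonBridge e → ∀ {y z} → Walk U y z → Walk (_≢ e) y z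
  reroute {e} around = concat ∘′ Star.map hop
    where
    hop : ∀ {y z} → Joined U y z → Walk (_≢ e) y z
    hop (f , _ , ey , ez) with f FinP.≟ e
    ... | no f≢e = (f , f≢e , ey , ez) ◅ ε
    hop (f , _ , inj₁ refl , inj₁ refl) | yes refl = ε
    hop (f , _ , inj₁ refl , inj₂ refl) | yes refl = around
    hop (f , _ , inj₂ refl , inj₁ refl) | yes refl = walk-reverse around
    hop (f , _ , inj₂ refl , inj₂ refl) | yes refl = ε

  lift : ∀ {e a b} → Walk (_≢ e) a b → Star (Avoiding A′ (midpoint e)) (vertex a) (vertex b)
  lift {e} = concat ∘′ gmap vertex through-midpoint
    where
    through-midpoint : ∀ {y z} → Joined (_≢ e) y z → Star (Avoiding A′ (midpoint e)) (vertex y) (vertex z)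
    through-midpoint (f , f≢e , ey , ez) =
      (vertex-midpoint ey , vertex≢midpoint , f≢e ∘′ midpoint-injective) ◅
      (midpoint-vertex ez , f≢e ∘′ midpoint-injective , vertex≢midpoint) ◅ ε

  project : ∀ {e s t} → Star (Avoiding A′ (midpoint e)) s t →
            ∀ {y z} → s ≡ vertex y → t ≡ vertex z → Walk (_≢ e) y z
  project ε refl t≡z = subst (Walk _ _) (vertex-injective t≡z) ε
  project ((a , _ , _) ◅ ε) refl refl = ⊥-elim (vertex-vertex⁻ a)
  project ((a , _ , m≢e) ◅ (a′ , _ , _) ◅ steps) refl t≡z with neighbour-of-vertex a
  ... | f , refl , ey with neighbour-of-midpoint a′
  ...   | y′ , refl , ey′ = (f , m≢e ∘′ cong midpoint , ey , ey′) ◅ project steps refl t≡z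

  nonBridge⇒detour : ∀ {e} → NonBridge e → Detour A′ (midpoint e)
  nonBridge⇒detour {e} around =
    vertex (end₁ e) , vertex (end₂ e) , end₁≢end₂ e ∘′ vertex-injective ,
    midpoint-vertex (inj₁ refl) , vertex-midpoint (inj₂ refl) , lift around

  detour⇒nonBridge : ∀ {e} → Detour A′ (midpoint e) → NonBridge e
  detour⇒nonBridge {e} (_ , _ , p≢q , ep , qe , steps)
    with neighbour-of-midpoint ep | neighbour-of-midpoint′ qe
  ... | y , refl , ey | z , refl , ez = orient ey ez (project steps refl refl)
    where
    orient : IsEndpoint G y e → IsEndpoint G z e → Walk (_≢ e) y z → NonBridge e
    orient (inj₁ refl) (inj₁ refl) _ = ⊥-elim (p≢q refl)
    orient (inj₁ refl) (inj₂ refl) w = w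
    orient (inj₂ refl) (inj₁ refl) w = walk-reverse w
    orient (inj₂ refl) (inj₂ refl) _ = ⊥-elim (p≢q refl)

  -- A cycle alternates between vertices and midpoints, so one of its first two entries is a midpoint.
  cycle⇒nonBridge : HasCycle A′ → ∃ NonBridge
  cycle⇒nonBridge (_ , v , inj , consecutive , closing) =
    at-midpoint (kind (v F.zero)) (kind (v (F.suc F.zero))) (consecutive F.zero)
      (cycle⇒detour₀ A′ inj consecutive closing) (cycle⇒detour₁ A′ inj consecutive closing)
    where
    at-midpoint : ∀ {w w′} → Kind w → Kind w′ → A′ w w′ → Detour A′ w → Detour A′ w′ → ∃ NonBridge
    at-midpoint (middle e) _ _ d _ = e , detour⇒nonBridge d
    at-midpoint (original _) (middle e) _ _ d = e , detour⇒nonBridge d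
    at-midpoint (original _) (original _) a _ _ = ⊥-elim (vertex-vertex⁻ a)

  module _ (r : Fin nV) (reach : ∀ y → Walk U r y) where

    Spanned : Subset nV → Set
    Spanned C = r ∈ C × ∃ λ T → (∀ {y} → y ∈ C → Walk (_∈ T) r y) × suc ∣ T ∣ ≤ ∣ C ∣

    span-step : ∀ C → Spanned C → (∀ y → y ∈ C) ⊎ ∃ λ z → z ∉ C × Spanned (C ∪ ⁅ z ⁆)
    span-step C (r∈C , T , walks , size) with ∀-or-∃¬ (_∈? C)
    ... | inj₁ all = inj₁ all
    ... | inj₂ (y , y∉C) with Star-crossing (_∈? C) (reach y) r∈C y∉C
    ...   | x , z , (f , _ , ex , ez) , x∈C , z∉C =
      inj₂ (z , z∉C , p⊆p∪q ⁅ z ⁆ r∈C , T ∪ ⁅ f ⁆ , walks′ , size′)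
      where
      widen : ∀ {w} → Walk (_∈ T) r w → Walk (_∈ T ∪ ⁅ f ⁆) r w
      widen = walk-restrict (p⊆p∪q ⁅ f ⁆)
      walks′ : ∀ {w} → w ∈ C ∪ ⁅ z ⁆ → Walk (_∈ T ∪ ⁅ f ⁆) r w
      walks′ w∈ with x∈p∪⁅y⁆⁻ C z w∈
      ... | inj₁ w∈C = widen (walks w∈C)
      ... | inj₂ refl = widen (walks x∈C) ◅◅ (f , q⊆p∪q T ⁅ f ⁆ (x∈⁅x⁆ f) , ex , ez) ◅ ε
      size′ : suc ∣ T ∪ ⁅ f ⁆ ∣ ≤ ∣ C ∪ ⁅ z ⁆ ∣
      size′ = ≤-trans (s≤s (∣p∪⁅x⁆∣≤1+∣p∣ T f)) (≤-trans (s≤s size) (x∉p⇒∣p∣<∣p∪⁅x⁆∣ C z∉C))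

    spanning-edges : ∃ λ T → (∀ y → Walk (_∈ T) r y) × suc ∣ T ∣ ≤ nV
    spanning-edges =
      let (C , (_ , T , walks , size) , all) = saturate Spanned (λ C → ∀ y → y ∈ C) span-step ⁅ r ⁆ root
      in T , (λ y → walks (all y)) , ≤-trans size (∣p∣≤n C)
      where
      root : Spanned ⁅ r ⁆
      root = x∈⁅x⁆ r , ⊥ , (λ y∈ → subst (Walk _ r) (sym (x∈⁅y⁆⇒x≡y r y∈)) ε) ,
             ≤-reflexive (trans (cong suc (∣⊥∣≡0 nE)) (sym (∣⁅x⁆∣≡1 r)))

  outside-spanning⇒nonBridge : ∀ {r T e} → (∀ y → Walk (_∈ T) r y) → e ∉ T → NonBridge e
  outside-spanning⇒nonBridge {T = T} {e} walks e∉T =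
    walk-restrict (λ f∈T f≡e → e∉T (subst (_∈ T) f≡e f∈T)) (walk-reverse (walks (end₁ e)) ◅◅ walks (end₂ e))

  bridges⇒nE<nV : Connected (adj G) → (∀ e → ¬ NonBridge e) → nE < nV
  bridges⇒nE<nV conn bridges =
    let (T , walks , size) = spanning-edges (proj₁ conn) (connected⇒walk conn (proj₁ conn))
        ⊤⊆T : ⊤ ⊆ T
        ⊤⊆T {e} _ = decidable-stable (e ∈? T) (bridges e ∘′ outside-spanning⇒nonBridge walks)
    in ≤-trans (s≤s (subst (_≤ ∣ T ∣) (∣⊤∣≡n nE) (p⊆q⇒∣p∣≤∣q∣ ⊤⊆T))) size

  covered : ∀ {C} → (∀ y → vertex y ∈ C) → (∀ f → midpoint f ∈ C) → C ≡ ⊤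
  covered {C} vertices∈C midpoints∈C = ⊆-antisym ⊆⊤ (λ {w} _ → by-kind (kind w))
    where
    by-kind : ∀ {w} → Kind w → w ∈ C
    by-kind (original y) = vertices∈C y
    by-kind (middle f) = midpoints∈C f

  Reached : Subset (nV + nE) → Subset (nV + nE) → Set
  Reached S C = Star (ForceStep A′ S) S C × (∀ f → midpoint f ∈ C → midpoint f ∈ S)

  module _ {P : Pred (Fin nE) 0ℓ} {S : Subset (nV + nE)} {a : Fin nV}
           (a∈S : vertex a ∈ S) (P⊆S : ∀ {f} → P f → midpoint f ∈ S) (reach : ∀ y → Walk P a y) where

    -- Along a P-edge leaving the coloured vertices, its midpoint has one uncoloured neighbour.
    force-outward : ∀ C → Reached S C → (∀ y → vertex y ∈ C) ⊎ ∃ λ u → u ∉ C × Reached S (C ∪ ⁅ u ⁆)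
    force-outward C (steps , midpoints⊆S) with ∀-or-∃¬ (λ y → vertex y ∈? C)
    ... | inj₁ all = inj₁ all
    ... | inj₂ (y , y∉C) with Star-crossing (λ x → vertex x ∈? C) (reach y) (forcing-⊆ steps a∈S) y∉C
    ...   | x , z , (f , Pf , ex , ez) , x∈C , z∉C =
      inj₂ (vertex z , z∉C , steps ◅◅ forcing ◅ ε , midpoints⊆S′)
      where
      x≢z : x ≢ z
      x≢z refl = z∉C x∈C
      others : ∀ w → A′ (midpoint f) w → w ≢ vertex z → w ∈ C
      others w a w≢z with neighbour-of-midpoint a
      ... | w′ , refl , ew′ =
        subst (λ v → vertex v ∈ C) (sym (other-endpoint ew′ ex ez x≢z (w≢z ∘′ cong vertex))) x∈C
      forcing : ForceStep A′ S C (C ∪ ⁅ vertex z ⁆)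
      forcing = force (midpoint f) (vertex z) (P⊆S Pf) (forcing-⊆ steps (P⊆S Pf))
                      (midpoint-vertex ez) z∉C others
      midpoints⊆S′ : ∀ g → midpoint g ∈ C ∪ ⁅ vertex z ⁆ → midpoint g ∈ S
      midpoints⊆S′ g g∈ with x∈p∪⁅y⁆⁻ C (vertex z) g∈
      ... | inj₁ g∈C = midpoints⊆S g g∈C
      ... | inj₂ eq = ⊥-elim (vertex≢midpoint (sym eq))

    colour-vertices : ∃ λ C → Reached S C × (∀ y → vertex y ∈ C)
    colour-vertices = saturate (Reached S) (λ C → ∀ y → vertex y ∈ C) force-outward S (ε , λ _ f∈ → f∈)

  rooted-czf : (r : Fin nV) → (∀ y → Walk U r y) → IsCZFSet A′ (⁅ r ⁆ ++ ⊤)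
  rooted-czf r reach =
    let (C , (steps , _) , vertices∈C) = colour-vertices {P = U} r∈S (λ _ → midpoint∈S) reach
    in subst (Star _ _) (covered vertices∈C (λ _ → forcing-⊆ steps midpoint∈S)) steps
    where
    r∈S : vertex r ∈ ⁅ r ⁆ ++ ⊤
    r∈S = ∈-++⁺ˡ (x∈⁅x⁆ r)
    midpoint∈S : ∀ {f} → midpoint f ∈ ⁅ r ⁆ ++ ⊤
    midpoint∈S = ∈-++⁺ʳ ⁅ r ⁆ ∈⊤

  -- Once all vertices are coloured, end₁ e has midpoint e as its only uncoloured neighbour.
  nonBridge-czf : Connected (adj G) → ∀ {e} → NonBridge e → IsCZFSet A′ (⁅ end₁ e ⁆ ++ ∁ ⁅ e ⁆)
  nonBridge-czf conn {e} around =
    let (_ , reached , vertices∈C) =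
          colour-vertices a∈S P⊆S (λ y → reroute around (connected⇒walk conn (end₁ e) y))
    in complete reached vertices∈C
    where
    S : Subset (nV + nE)
    S = ⁅ end₁ e ⁆ ++ ∁ ⁅ e ⁆
    a∈S : vertex (end₁ e) ∈ S
    a∈S = ∈-++⁺ˡ (x∈⁅x⁆ (end₁ e))
    P⊆S : ∀ {f} → f ≢ e → midpoint f ∈ S
    P⊆S f≢e = ∈-++⁺ʳ ⁅ end₁ e ⁆ (x∉p⇒x∈∁p (x≢y⇒x∉⁅y⁆ f≢e))
    complete : ∀ {C} → Reached S C → (∀ y → vertex y ∈ C) → IsCZFSet A′ S
    complete {C} (steps , midpoints⊆S) vertices∈C =
      subst (Star _ _) (covered (λ y → p⊆p∪q ⁅ midpoint e ⁆ (vertices∈C y)) midpoints∈C′)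
        (steps ◅◅ last ◅ ε)
      where
      e∉C : midpoint e ∉ C
      e∉C e∈C = x∈∁p⇒x∉p (∈-++⁻ʳ ⁅ end₁ e ⁆ (midpoints⊆S e e∈C)) (x∈⁅x⁆ e)
      others : ∀ w → A′ (vertex (end₁ e)) w → w ≢ midpoint e → w ∈ C
      others w a w≢e with neighbour-of-vertex a
      ... | f , refl , _ = forcing-⊆ steps (P⊆S (w≢e ∘′ cong midpoint))
      last : ForceStep A′ S C (C ∪ ⁅ midpoint e ⁆)
      last = force (vertex (end₁ e)) (midpoint e) a∈S (forcing-⊆ steps a∈S)
                   (vertex-midpoint (inj₁ refl)) e∉C others
      midpoints∈C′ : ∀ f → midpoint f ∈ C ∪ ⁅ midpoint e ⁆
      midpoints∈C′ f with f FinP.≟ e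
      ... | yes refl = q⊆p∪q C _ (x∈⁅x⁆ (midpoint e))
      ... | no f≢e = p⊆p∪q ⁅ midpoint e ⁆ (forcing-⊆ steps (P⊆S f≢e))

  nonBridge⇒cycle : ∀ {e} → NonBridge e → HasCycle A′
  nonBridge⇒cycle = detour⇒cycle A′ ∘′ nonBridge⇒detour

  vertices midpoints : Subset (nV + nE)
  vertices = ⊤ {nV} ++ ⊥ {nE}
  midpoints = ⊥ {nV} ++ ⊤ {nE}

  vertices-independent : Independent A′ vertices
  vertices-independent x y x∈ y∈ with kind x | kind y
  ... | middle _ | _ = λ _ → ∉⊥ (∈-++⁻ʳ (⊤ {nV}) x∈)
  ... | original _ | middle _ = λ _ → ∉⊥ (∈-++⁻ʳ (⊤ {nV}) y∈)
  ... | original _ | original _ = vertex-vertex⁻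

  midpoints-independent : Independent A′ midpoints
  midpoints-independent x y x∈ y∈ with kind x | kind y
  ... | original _ | _ = λ _ → ∉⊥ (∈-++⁻ˡ (⊤ {nE}) x∈)
  ... | middle _ | original _ = λ _ → ∉⊥ (∈-++⁻ˡ (⊤ {nE}) y∈)
  ... | middle _ | middle _ = midpoint-midpoint⁻

  ∣vertices∣ : ∣ vertices ∣ ≡ nV
  ∣vertices∣ = trans (∣p++q∣≡∣p∣+∣q∣ (⊤ {nV}) ⊥) (trans (cong₂ _+_ (∣⊤∣≡n nV) (∣⊥∣≡0 nE)) (+-identityʳ nV))

  ∣midpoints∣ : ∣ midpoints ∣ ≡ nE
  ∣midpoints∣ = trans (∣p++q∣≡∣p∣+∣q∣ (⊥ {nV}) ⊤) (cong₂ _+_ (∣⊥∣≡0 nV) (∣⊤∣≡n nE))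

mainTheorem12 : (G : SimpleGraph) → Connected (adj G) →
    (IsTree (subdivision G) →
       IsCZFNumber (subdivision G) (suc (numEdges G)) ×
       IsIndependenceNumber (subdivision G) (suc (numEdges G))) ×
    (HasCycle (subdivision G) →
       IsCZFNumber (subdivision G) (numEdges G) ×
       IsIndependenceNumber (subdivision G) (numEdges G))
mainTheorem12 G conn = tree-case , cycle-case
  where
  open Subdivision G
  r : Fin nV
  r = proj₁ conn
  rooted : IsCZFSet A′ (⁅ r ⁆ ++ ⊤)
  rooted = rooted-czf r (connected⇒walk conn r)
  ∣rooted∣ : ∣ ⁅ r ⁆ ++ ⊤ {nE} ∣ ≡ suc nE
  ∣rooted∣ = trans (∣⁅x⁆++p∣≡1+∣p∣ r ⊤) (cong suc (∣⊤∣≡n nE))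

  tree-case : IsTree A′ → IsCZFNumber A′ (suc nE) × IsIndependenceNumber A′ (suc nE)
  tree-case (_ , acyclic) = czf≡α rooted vertices-independent ∣rooted∣ (trans ∣vertices∣ nV≡1+nE)
    where
    nV≡1+nE : nV ≡ suc nE
    nV≡1+nE = ≤-antisym (subst₂ _≤_ ∣vertices∣ ∣rooted∣ (independent≤czf vertices-independent rooted))
                        (bridges⇒nE<nV conn (λ _ → acyclic ∘′ nonBridge⇒cycle))

  cycle-case : HasCycle A′ → IsCZFNumber A′ nE × IsIndependenceNumber A′ nE
  cycle-case cyc =
    let (e , around) = cycle⇒nonBridge cyc
    in czf≡α (nonBridge-czf conn around) midpoints-independent
         (trans (∣⁅x⁆++p∣≡1+∣p∣ (end₁ e) (∁ ⁅ e ⁆)) (1+∣∁⁅x⁆∣≡n e)) ∣midpoints∣
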